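{- For a positive integer $d$ define $$h(d):=\limsup_{n\to\infty}\frac{e_d(n)}{n}.$$ If $d$ is odd, then $h(d)=0$. If $d$ is even, then $h(d)=2/d$.
   Context: For $n\geqslant 1$, $Q_n$ denotes the $n$-dimensional hypercube: its vertices are all binary sequences $x=(x_i)_{i=1,\dots,n}$, and it is equipped with the Hamming distance $\rho(x,y)=|\{i : x_i\neq y_i\}|$. For a positive integer $d$, a non-empty subset $S\subseteq Q_n$ is called $d$-equilateral if $\rho(x,y)=d$ for all distinct $x,y\in S$. $e_d(n)$ denotes the maximal cardinality of a $d$-equilateral subset of $Q_n$ (so $e_d(n)=1$ if $d>n$). -}

module Defs where

open import Data.Bool using (Bool; true; false; _xor_; if_then_else_)
open import Data.Nat using (ℕ; zero; suc; _+_; _*_; _≤_)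
open import Data.Vec using (Vec; []; _∷_)
open import Data.List using (List; length; [])
open import Data.List.Membership.Propositional using (_∈_)
open import Data.List.Relation.Unary.Unique.Propositional using (Unique)
open import Data.Product using (Σ; _×_; ∃)
open import Relation.Binary.PropositionalEquality using (_≡_; _≢_)

Vertex : ℕ → Set
Vertex n = Vec Bool n

ρ : ∀ {n} → Vertex n → Vertex n → ℕ
ρ [] [] = 0
ρ (a ∷ x) (b ∷ y) = (if a xor b then 1 else 0) + ρ x y

-- A finite subset of Q_n is a duplicate-free list; its cardinality is its length.
-- d-equilateral: non-empty, and all distinct points at distance exactly d.
Equilateral : ℕ → ∀ {n} → List (Vertex n) → Set
Equilateral d S =
  (S ≢ []) × Unique S × (∀ {x y} → x ∈ S → y ∈ S → x ≢ y → ρ x y ≡ d)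

-- m = e_d(n): m is the maximal cardinality of a d-equilateral subset of Q_n.
IsEqMax : ℕ → ℕ → ℕ → Set
IsEqMax d n m =
  (Σ (List (Vertex n)) λ S → Equilateral d S × length S ≡ m)
  × (∀ (S : List (Vertex n)) → Equilateral d S → length S ≤ m)

-- limsup_{n→∞} f(n)/n = p/q  (q > 0), via the ε-characterization with ε = 1/k:
--  (upper) ∀ k ≥ 1, eventually f(n)/n ≤ p/q + 1/k   i.e. k q f(n) ≤ k p n + q n
--  (lower) ∀ k ≥ 1, ∀ N, ∃ n ≥ N with f(n)/n ≥ p/q - 1/k   i.e. k p n ≤ k q f(n) + q n
LimsupRatio : (ℕ → ℕ) → ℕ → ℕ → Set
LimsupRatio f p q =
  (∀ k → 1 ≤ k → ∃ λ N → ∀ n → N ≤ n → k * q * f n ≤ k * p * n + q * n)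
  × (∀ k → 1 ≤ k → ∀ N → ∃ λ n → N ≤ n × 1 ≤ n × k * p * n ≤ k * q * f n + q * n)

Odd : ℕ → Set
Odd d = ∃ λ j → d ≡ suc (2 * j)

Even : ℕ → Set
Even d = ∃ λ j → d ≡ 2 * j

module Submission where

-- A vertex of Q_n is read as a subset of {1..n}; then ρ(x, y) = ∣x ⊕ y∣, and
-- ∣p ⊕ q∣ + 2∣p ∩ q∣ = ∣p∣ + ∣q∣.  For an equilateral triangle z, x, y of side d
-- this gives 2∣(z ⊕ x) ∩ (z ⊕ y)∣ = d.
--  * d odd: no three points are pairwise at distance d, so e_d(n) ≤ 2 and h(d) = 0.
--  * d = 2j: translating a d-equilateral set z ∷ S by z yields a family of 2j-sets
--    with pairwise intersections j.  A Deza-type dichotomy bounds such a family: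
--    either all members have the same trace on one fixed member A (then the parts
--    outside A are disjoint j-sets, at most n/j of them) or two traces differ (then
--    the members are separated by their traces on a set of size ≤ 8j, at most 2^(8j)
--    of them).  So j·e_d(n) ≤ n + O_j(1).  Conversely m disjoint blocks of j ones
--    form a d-equilateral set in Q_{m·j}, so e_d(m·j) ≥ m.
-- A squeeze lemma turns these two bounds into limsup e_d(n)/n = 2/d.

open import Data.Bool using (Bool; true; false; _xor_; not; _∧_; if_then_else_)
open import Data.Bool.Properties using (not-involutive; ∧-identityʳ; ∧-zeroʳ)
import Data.Bool.Properties as Bool
open import Data.Empty using (⊥; ⊥-elim)
open import Data.Fin using () renaming (zero to zeroᶠ)
open import Data.Fin.Subset using (Subset; _∩_; _∪_; _─_; ∣_∣; _⊆_; ⋃) renaming (⊥ to ∅; ⊤ to full; _∈_ to _∈ₛ_)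
open import Data.Fin.Subset.Properties
  using (∣p∣≤n; ∣⊥∣≡0; ∣p∩q∣≤∣p∣; p⊆q⇒∣p∣≤∣q∣; p∩q⊆p; p∩q⊆q; x∈p∩q⁺; x∈p∩q⁻;
         p⊆p∪q; q⊆p∪q; drop-∷-⊆; ∩-comm; ∩-idem; ∩-zeroʳ; ∩-distribˡ-∪)
open import Data.List using (List; []; _∷_; length; map)
open import Data.List.Properties using (length-map)
open import Data.List.Membership.Propositional using (_∈_; find)
open import Data.List.Membership.Propositional.Properties using (∈-map⁻)
open import Data.List.Relation.Unary.All as All using (All; []; _∷_)
import Data.List.Relation.Unary.All.Properties as All
open import Data.List.Relation.Unary.All.Properties using (¬All⇒Any¬)
open import Data.List.Relation.Unary.AllPairs as AllPairs using (AllPairs; []; _∷_)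
import Data.List.Relation.Unary.AllPairs.Properties as AllPairs
open import Data.List.Relation.Unary.Any using (here; there)
open import Data.List.Relation.Unary.Unique.Propositional using (Unique)
import Data.List.Relation.Unary.Unique.Propositional.Properties as Unique
open import Data.Nat using (ℕ; zero; suc; _+_; _*_; _∸_; _^_; _≤_; _<_; z≤n; s≤s)
open import Data.Nat.Properties
open import Data.Nat.Tactic.RingSolver using (solve-∀)
open import Data.Product using (_×_; _,_; ∃)
open import Data.Sum using (_⊎_; inj₁; inj₂)
open import Data.Vec using ([]; _∷_; _++_; zipWith) renaming (here to hereᵥ)
open import Data.Vec.Properties using (≡-dec)
open import Relation.Binary.Definitions using (DecidableEquality)
open import Relation.Binary.PropositionalEquality
open import Relation.Nullary using (¬_; yes; no)

open import Defs

_⊕_ : ∀ {n} → Subset n → Subset n → Subset n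
_⊕_ = zipWith _xor_

infixl 6 _⊕_

bit : Bool → ℕ
bit b = if b then 1 else 0

∣∷∣ : ∀ {n} b (p : Subset n) → ∣ b ∷ p ∣ ≡ bit b + ∣ p ∣
∣∷∣ true p = refl
∣∷∣ false p = refl

ρ≡∣⊕∣ : ∀ {n} (x y : Vertex n) → ρ x y ≡ ∣ x ⊕ y ∣
ρ≡∣⊕∣ [] [] = refl
ρ≡∣⊕∣ (a ∷ x) (b ∷ y) = trans (cong (bit (a xor b) +_) (ρ≡∣⊕∣ x y)) (sym (∣∷∣ (a xor b) (x ⊕ y)))

-- Sizes of a symmetric difference: the points of p ∩ q are counted twice by ∣p∣ + ∣q∣.
∣⊕∣+2∣∩∣ : ∀ {n} (p q : Subset n) → ∣ p ⊕ q ∣ + 2 * ∣ p ∩ q ∣ ≡ ∣ p ∣ + ∣ q ∣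
∣⊕∣+2∣∩∣ [] [] = refl
∣⊕∣+2∣∩∣ (false ∷ p) (false ∷ q) = ∣⊕∣+2∣∩∣ p q
∣⊕∣+2∣∩∣ (false ∷ p) (true ∷ q) = trans (cong suc (∣⊕∣+2∣∩∣ p q)) (sym (+-suc ∣ p ∣ ∣ q ∣))
∣⊕∣+2∣∩∣ (true ∷ p) (false ∷ q) = cong suc (∣⊕∣+2∣∩∣ p q)
∣⊕∣+2∣∩∣ (true ∷ p) (true ∷ q) = begin
  ∣ p ⊕ q ∣ + 2 * suc ∣ p ∩ q ∣     ≡⟨ two-more ∣ p ⊕ q ∣ ∣ p ∩ q ∣ ⟩
  2 + (∣ p ⊕ q ∣ + 2 * ∣ p ∩ q ∣)   ≡⟨ cong (2 +_) (∣⊕∣+2∣∩∣ p q) ⟩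
  2 + (∣ p ∣ + ∣ q ∣)               ≡⟨ cong suc (sym (+-suc ∣ p ∣ ∣ q ∣)) ⟩
  suc ∣ p ∣ + suc ∣ q ∣             ∎
  where
    open ≡-Reasoning
    two-more : ∀ x m → x + 2 * suc m ≡ 2 + (x + 2 * m)
    two-more = solve-∀

∣∪∣+∣∩∣ : ∀ {n} (p q : Subset n) → ∣ p ∪ q ∣ + ∣ p ∩ q ∣ ≡ ∣ p ∣ + ∣ q ∣
∣∪∣+∣∩∣ [] [] = refl
∣∪∣+∣∩∣ (false ∷ p) (false ∷ q) = ∣∪∣+∣∩∣ p q
∣∪∣+∣∩∣ (false ∷ p) (true ∷ q) = trans (cong suc (∣∪∣+∣∩∣ p q)) (sym (+-suc ∣ p ∣ ∣ q ∣))
∣∪∣+∣∩∣ (true ∷ p) (false ∷ q) = cong suc (∣∪∣+∣∩∣ p q)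
∣∪∣+∣∩∣ (true ∷ p) (true ∷ q) =
  cong suc (trans (+-suc ∣ p ∪ q ∣ ∣ p ∩ q ∣) (trans (cong suc (∣∪∣+∣∩∣ p q)) (sym (+-suc ∣ p ∣ ∣ q ∣))))

∣p∪q∣≤∣p∣+∣q∣ : ∀ {n} (p q : Subset n) → ∣ p ∪ q ∣ ≤ ∣ p ∣ + ∣ q ∣
∣p∪q∣≤∣p∣+∣q∣ p q = ≤-trans (m≤m+n ∣ p ∪ q ∣ ∣ p ∩ q ∣) (≤-reflexive (∣∪∣+∣∩∣ p q))

∣p∣≡∣p∩q∣+∣p─q∣ : ∀ {n} (p q : Subset n) → ∣ p ∣ ≡ ∣ p ∩ q ∣ + ∣ p ─ q ∣
∣p∣≡∣p∩q∣+∣p─q∣ [] [] = refl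
∣p∣≡∣p∩q∣+∣p─q∣ (false ∷ p) (false ∷ q) = ∣p∣≡∣p∩q∣+∣p─q∣ p q
∣p∣≡∣p∩q∣+∣p─q∣ (false ∷ p) (true ∷ q) = ∣p∣≡∣p∩q∣+∣p─q∣ p q
∣p∣≡∣p∩q∣+∣p─q∣ (true ∷ p) (false ∷ q) = trans (cong suc (∣p∣≡∣p∩q∣+∣p─q∣ p q)) (sym (+-suc ∣ p ∩ q ∣ ∣ p ─ q ∣))
∣p∣≡∣p∩q∣+∣p─q∣ (true ∷ p) (true ∷ q) = cong suc (∣p∣≡∣p∩q∣+∣p─q∣ p q)

∣p∩q∣≡∣p∣⇒p∩q≡p : ∀ {n} (p q : Subset n) → ∣ p ∩ q ∣ ≡ ∣ p ∣ → p ∩ q ≡ p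
∣p∩q∣≡∣p∣⇒p∩q≡p [] [] _ = refl
∣p∩q∣≡∣p∣⇒p∩q≡p (false ∷ p) (b ∷ q) eq = cong (false ∷_) (∣p∩q∣≡∣p∣⇒p∩q≡p p q eq)
∣p∩q∣≡∣p∣⇒p∩q≡p (true ∷ p) (true ∷ q) eq = cong (true ∷_) (∣p∩q∣≡∣p∣⇒p∩q≡p p q (suc-injective eq))
∣p∩q∣≡∣p∣⇒p∩q≡p (true ∷ p) (false ∷ q) eq = ⊥-elim (<⇒≱ (s≤s ≤-refl) (subst (_≤ ∣ p ∣) eq (∣p∩q∣≤∣p∣ p q)))

∣p∩q∣<m : ∀ {n m} (p q : Subset n) → ∣ p ∣ ≡ m → ∣ q ∣ ≡ m → p ≢ q → ∣ p ∩ q ∣ < m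
∣p∩q∣<m p q ∣p∣≡m ∣q∣≡m p≢q = ≤∧≢⇒< (subst (∣ p ∩ q ∣ ≤_) ∣p∣≡m (∣p∩q∣≤∣p∣ p q)) λ ∣p∩q∣≡m →
  p≢q (begin
    p      ≡⟨ sym (∣p∩q∣≡∣p∣⇒p∩q≡p p q (trans ∣p∩q∣≡m (sym ∣p∣≡m))) ⟩
    p ∩ q  ≡⟨ ∩-comm p q ⟩
    q ∩ p  ≡⟨ ∣p∩q∣≡∣p∣⇒p∩q≡p q p (trans (cong ∣_∣ (∩-comm q p)) (trans ∣p∩q∣≡m (sym ∣q∣≡m))) ⟩
    q      ∎)
  where open ≡-Reasoning

∣p∩q∣≤∣p∩r∣ : ∀ {n} (p : Subset n) {q r : Subset n} → q ⊆ r → ∣ p ∩ q ∣ ≤ ∣ p ∩ r ∣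
∣p∩q∣≤∣p∩r∣ p {q} q⊆r = p⊆q⇒∣p∣≤∣q∣ λ x∈p∩q →
  let x∈p , x∈q = x∈p∩q⁻ p q x∈p∩q in x∈p∩q⁺ (x∈p , q⊆r x∈q)

─-∩-distrib : ∀ {n} (p q r : Subset n) → (p ─ r) ∩ (q ─ r) ≡ (p ∩ q) ─ r
─-∩-distrib [] [] [] = refl
─-∩-distrib (a ∷ p) (b ∷ q) (true ∷ r) = cong (false ∷_) (─-∩-distrib p q r)
─-∩-distrib (a ∷ p) (b ∷ q) (false ∷ r) = cong ((a ∧ b) ∷_) (─-∩-distrib p q r)

∩-trace : ∀ {n} (p q r : Subset n) → (p ∩ q) ∩ r ≡ (p ∩ r) ∩ (q ∩ r)
∩-trace [] [] [] = refl
∩-trace (false ∷ p) (b ∷ q) (c ∷ r) = cong (false ∷_) (∩-trace p q r)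
∩-trace (true ∷ p) (b ∷ q) (true ∷ r) = cong ((b ∧ true) ∷_) (∩-trace p q r)
∩-trace (true ∷ p) (b ∷ q) (false ∷ r) = cong₂ _∷_ (∧-zeroʳ b) (∩-trace p q r)

∩-trace-pair : ∀ {n} (p q r : Subset n) → (p ∩ r) ∩ (p ∩ q) ≡ (p ∩ r) ∩ (q ∩ r)
∩-trace-pair [] [] [] = refl
∩-trace-pair (false ∷ p) (b ∷ q) (c ∷ r) = cong (false ∷_) (∩-trace-pair p q r)
∩-trace-pair (true ∷ p) (b ∷ q) (false ∷ r) = cong (false ∷_) (∩-trace-pair p q r)
∩-trace-pair (true ∷ p) (b ∷ q) (true ∷ r) = cong₂ _∷_ (sym (∧-identityʳ b)) (∩-trace-pair p q r)

⊕-translate : ∀ {n} (z x y : Subset n) → (z ⊕ x) ⊕ (z ⊕ y) ≡ x ⊕ y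
⊕-translate [] [] [] = refl
⊕-translate (false ∷ z) (a ∷ x) (b ∷ y) = cong ((a xor b) ∷_) (⊕-translate z x y)
⊕-translate (true ∷ z) (false ∷ x) (b ∷ y) = cong₂ _∷_ (not-involutive b) (⊕-translate z x y)
⊕-translate (true ∷ z) (true ∷ x) (b ∷ y) = cong (not b ∷_) (⊕-translate z x y)

⊕-involutive : ∀ {n} (z x : Subset n) → z ⊕ (z ⊕ x) ≡ x
⊕-involutive [] [] = refl
⊕-involutive (false ∷ z) (a ∷ x) = cong (a ∷_) (⊕-involutive z x)
⊕-involutive (true ∷ z) (a ∷ x) = cong₂ _∷_ (not-involutive a) (⊕-involutive z x)

⊕-injective : ∀ {n} (z : Subset n) {x y : Subset n} → z ⊕ x ≡ z ⊕ y → x ≡ y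
⊕-injective z {x} {y} eq = trans (sym (⊕-involutive z x)) (trans (cong (z ⊕_) eq) (⊕-involutive z y))

equilateral-triangle : ∀ {n d} (z x y : Vertex n) → ρ z x ≡ d → ρ z y ≡ d → ρ x y ≡ d
  → 2 * ∣ (z ⊕ x) ∩ (z ⊕ y) ∣ ≡ d
equilateral-triangle {d = d} z x y zx zy xy = +-cancelˡ-≡ d _ _ (begin
  d + 2 * ∣ X ∩ Y ∣         ≡⟨ cong (_+ 2 * ∣ X ∩ Y ∣) (sym xy) ⟩
  ρ x y + 2 * ∣ X ∩ Y ∣     ≡⟨ cong (_+ 2 * ∣ X ∩ Y ∣) (trans (ρ≡∣⊕∣ x y) (cong ∣_∣ (sym (⊕-translate z x y)))) ⟩
  ∣ X ⊕ Y ∣ + 2 * ∣ X ∩ Y ∣ ≡⟨ ∣⊕∣+2∣∩∣ X Y ⟩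
  ∣ X ∣ + ∣ Y ∣             ≡⟨ cong₂ _+_ (trans (sym (ρ≡∣⊕∣ z x)) zx) (trans (sym (ρ≡∣⊕∣ z y)) zy) ⟩
  d + d                     ∎)
  where
    open ≡-Reasoning
    X Y : Subset _
    X = z ⊕ x
    Y = z ⊕ y

odd-equilateral-size : ∀ {n} i (S : List (Vertex n)) → Equilateral (suc (2 * i)) S → length S ≤ 2
odd-equilateral-size i [] _ = z≤n
odd-equilateral-size i (_ ∷ []) _ = s≤s z≤n
odd-equilateral-size i (_ ∷ _ ∷ []) _ = s≤s (s≤s z≤n)
odd-equilateral-size i (x ∷ y ∷ z ∷ S) (_ , (x≢y ∷ x≢z ∷ _) ∷ (y≢z ∷ _) ∷ _ , dist) =
  ⊥-elim (even≢odd ∣ (x ⊕ y) ∩ (x ⊕ z) ∣ i (equilateral-triangle x y z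
    (dist x∈ y∈ x≢y) (dist x∈ z∈ x≢z) (dist y∈ z∈ y≢z)))
  where
    x∈ : x ∈ x ∷ y ∷ z ∷ S
    x∈ = here refl
    y∈ : y ∈ x ∷ y ∷ z ∷ S
    y∈ = there (here refl)
    z∈ : z ∈ x ∷ y ∷ z ∷ S
    z∈ = there (there (here refl))

Pairwise : ∀ {A : Set} → (A → A → Set) → List A → Set
Pairwise R xs = ∀ {x y} → x ∈ xs → y ∈ xs → x ≢ y → R x y

allPairs⇒pairwise : ∀ {A : Set} {R : A → A → Set} → (∀ {x y} → R x y → R y x)
  → ∀ {xs} → AllPairs R xs → Pairwise R xs
allPairs⇒pairwise R-sym (_ ∷ _) (here refl) (here refl) x≢y = ⊥-elim (x≢y refl)
allPairs⇒pairwise R-sym (Rx ∷ _) (here refl) (there y∈) _ = All.lookup Rx y∈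
allPairs⇒pairwise R-sym (Rx ∷ _) (there x∈) (here refl) _ = R-sym (All.lookup Rx x∈)
allPairs⇒pairwise R-sym (_ ∷ Rxs) (there x∈) (there y∈) x≢y = allPairs⇒pairwise R-sym Rxs x∈ y∈ x≢y

map-unique : ∀ {A B : Set} (f : A → B) {xs : List A} → Unique xs
  → Pairwise (λ x y → f x ≢ f y) xs → Unique (map f xs)
map-unique f [] _ = []
map-unique f (x∉ ∷ uniq) separates =
  All.map⁺ (All.tabulate λ y∈ → separates (here refl) (there y∈) (All.lookup x∉ y∈))
  ∷ map-unique f uniq (λ x∈ y∈ → separates (there x∈) (there y∈))

slice : ∀ {n} → Bool → List (Subset (suc n)) → List (Subset n)
slice b [] = []
slice false ((false ∷ x) ∷ L) = x ∷ slice false L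
slice false ((true ∷ x) ∷ L) = slice false L
slice true ((false ∷ x) ∷ L) = slice true L
slice true ((true ∷ x) ∷ L) = x ∷ slice true L

∈-slice : ∀ {n} b (L : List (Subset (suc n))) {y} → y ∈ slice b L → (b ∷ y) ∈ L
∈-slice false ((false ∷ x) ∷ L) (here refl) = here refl
∈-slice false ((false ∷ x) ∷ L) (there y∈) = there (∈-slice false L y∈)
∈-slice false ((true ∷ x) ∷ L) y∈ = there (∈-slice false L y∈)
∈-slice true ((false ∷ x) ∷ L) y∈ = there (∈-slice true L y∈)
∈-slice true ((true ∷ x) ∷ L) (here refl) = here refl
∈-slice true ((true ∷ x) ∷ L) (there y∈) = there (∈-slice true L y∈)

length-slices : ∀ {n} (L : List (Subset (suc n))) → length L ≡ length (slice false L) + length (slice true L)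
length-slices [] = refl
length-slices ((false ∷ x) ∷ L) = cong suc (length-slices L)
length-slices ((true ∷ x) ∷ L) = trans (cong suc (length-slices L)) (sym (+-suc _ _))

slice-fresh : ∀ {n} b (L : List (Subset (suc n))) {x} → All (λ y → b ∷ x ≢ y) L → All (λ y → x ≢ y) (slice b L)
slice-fresh b L x∉ = All.tabulate λ y∈ x≡y → All.lookup x∉ (∈-slice b L y∈) (cong (b ∷_) x≡y)

slice-unique : ∀ {n} b (L : List (Subset (suc n))) → Unique L → Unique (slice b L)
slice-unique b [] [] = []
slice-unique false ((false ∷ x) ∷ L) (x∉ ∷ uniq) = slice-fresh false L x∉ ∷ slice-unique false L uniq
slice-unique false ((true ∷ x) ∷ L) (_ ∷ uniq) = slice-unique false L uniq
slice-unique true ((false ∷ x) ∷ L) (_ ∷ uniq) = slice-unique true L uniq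
slice-unique true ((true ∷ x) ∷ L) (x∉ ∷ uniq) = slice-fresh true L x∉ ∷ slice-unique true L uniq

slice-⊆ : ∀ {n} b (L : List (Subset (suc n))) {u U} → (∀ {X} → X ∈ L → X ⊆ u ∷ U)
  → ∀ {Y} → Y ∈ slice b L → Y ⊆ U
slice-⊆ b L sub Y∈ = drop-∷-⊆ (sub (∈-slice b L Y∈))

slice-outside : ∀ {n} (L : List (Subset (suc n))) {U} → (∀ {X} → X ∈ L → X ⊆ false ∷ U) → slice true L ≡ []
slice-outside L {U} sub = no-members (slice true L) λ Y∈ → outside (sub (∈-slice true L Y∈) hereᵥ)
  where
    outside : ¬ (zeroᶠ ∈ₛ false ∷ U)
    outside ()
    no-members : ∀ {A : Set} (xs : List A) → (∀ {y} → y ∈ xs → ⊥) → xs ≡ []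
    no-members [] _ = refl
    no-members (_ ∷ _) empty = ⊥-elim (empty (here refl))

subsets-bound : ∀ {n} (U : Subset n) (L : List (Subset n)) → Unique L → (∀ {X} → X ∈ L → X ⊆ U)
  → length L ≤ 2 ^ ∣ U ∣
subsets-bound [] [] _ _ = z≤n
subsets-bound [] (_ ∷ []) _ _ = ≤-refl
subsets-bound [] ([] ∷ [] ∷ _) ((x≢y ∷ _) ∷ _) _ = ⊥-elim (x≢y refl)
subsets-bound (false ∷ U) L uniq sub = begin
  length L                                        ≡⟨ length-slices L ⟩
  length (slice false L) + length (slice true L)  ≡⟨ cong (λ M → length (slice false L) + length M) (slice-outside L sub) ⟩
  length (slice false L) + 0                      ≡⟨ +-identityʳ _ ⟩
  length (slice false L)                          ≤⟨ subsets-bound U (slice false L) (slice-unique false L uniq) (slice-⊆ false L sub) ⟩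
  2 ^ ∣ U ∣                                       ∎
  where open ≤-Reasoning
subsets-bound (true ∷ U) L uniq sub = begin
  length L                                        ≡⟨ length-slices L ⟩
  length (slice false L) + length (slice true L)  ≤⟨ +-mono-≤ (half false) (half true) ⟩
  2 ^ ∣ U ∣ + 2 ^ ∣ U ∣                           ≡⟨ cong (2 ^ ∣ U ∣ +_) (sym (+-identityʳ _)) ⟩
  2 ^ suc ∣ U ∣                                   ∎
  where
    open ≤-Reasoning
    half : ∀ b → length (slice b L) ≤ 2 ^ ∣ U ∣
    half b = subsets-bound U (slice b L) (slice-unique b L uniq) (slice-⊆ b L sub)

disjoint-from-union : ∀ {n} (p : Subset n) (L : List (Subset n)) → (∀ {q} → q ∈ L → ∣ p ∩ q ∣ ≡ 0)
  → ∣ p ∩ ⋃ L ∣ ≡ 0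
disjoint-from-union {n} p [] _ = trans (cong ∣_∣ (∩-zeroʳ p)) (∣⊥∣≡0 n)
disjoint-from-union p (q ∷ L) disjoint = n≤0⇒n≡0 (begin
  ∣ p ∩ (q ∪ ⋃ L) ∣          ≡⟨ cong ∣_∣ (∩-distribˡ-∪ p q (⋃ L)) ⟩
  ∣ (p ∩ q) ∪ (p ∩ ⋃ L) ∣    ≤⟨ ∣p∪q∣≤∣p∣+∣q∣ (p ∩ q) (p ∩ ⋃ L) ⟩
  ∣ p ∩ q ∣ + ∣ p ∩ ⋃ L ∣    ≡⟨ cong₂ _+_ (disjoint (here refl)) (disjoint-from-union p L (λ q∈ → disjoint (there q∈))) ⟩
  0                          ∎)
  where open ≤-Reasoning

disjoint-family-bound : ∀ {A : Set} {n m} (f : A → Subset n) (xs : List A) → Unique xs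
  → (∀ {x} → x ∈ xs → m ≤ ∣ f x ∣) → Pairwise (λ x y → ∣ f x ∩ f y ∣ ≡ 0) xs
  → m * length xs ≤ ∣ ⋃ (map f xs) ∣
disjoint-family-bound {m = m} f [] _ _ _ = ≤-trans (≤-reflexive (*-zeroʳ m)) z≤n
disjoint-family-bound {m = m} f (x ∷ xs) (x∉ ∷ uniq) large disjoint = begin
  m * suc (length xs)             ≡⟨ *-suc m (length xs) ⟩
  m + m * length xs               ≤⟨ +-mono-≤ (large (here refl)) rest ⟩
  ∣ f x ∣ + ∣ V ∣                 ≡⟨ sym (∣∪∣+∣∩∣ (f x) V) ⟩
  ∣ f x ∪ V ∣ + ∣ f x ∩ V ∣       ≡⟨ cong (∣ f x ∪ V ∣ +_) (disjoint-from-union (f x) (map f xs) apart) ⟩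
  ∣ f x ∪ V ∣ + 0                 ≡⟨ +-identityʳ _ ⟩
  ∣ f x ∪ V ∣                     ∎
  where
    open ≤-Reasoning
    V : Subset _
    V = ⋃ (map f xs)
    rest : m * length xs ≤ ∣ V ∣
    rest = disjoint-family-bound f xs uniq (λ y∈ → large (there y∈)) (λ y∈ z∈ → disjoint (there y∈) (there z∈))
    apart : ∀ {q} → q ∈ map f xs → ∣ f x ∩ q ∣ ≡ 0
    apart q∈ with ∈-map⁻ f q∈
    ... | y , y∈ , refl = disjoint (here refl) (there y∈) (All.lookup x∉ y∈)

constant-or-separates : ∀ {A B : Set} → DecidableEquality B → (f : A → B) (xs : List A)
  → (∀ {x y} → x ∈ xs → y ∈ xs → f x ≡ f y) ⊎ (∃ λ x → ∃ λ y → x ∈ xs × y ∈ xs × f x ≢ f y)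
constant-or-separates _≟_ f [] = inj₁ λ ()
constant-or-separates _≟_ f (x ∷ xs) with All.all? (λ y → f y ≟ f x) xs
... | yes like-x = inj₁ λ y∈ z∈ → trans (as-x y∈) (sym (as-x z∈))
  where
    as-x : ∀ {y} → y ∈ x ∷ xs → f y ≡ f x
    as-x (here refl) = refl
    as-x (there y∈) = All.lookup like-x y∈
... | no ¬like-x with find (¬All⇒Any¬ (λ y → f y ≟ f x) xs ¬like-x)
...   | y , y∈ , fy≢fx = inj₂ (y , x , there y∈ , here refl , fy≢fx)

exceeds : ∀ {x y t} → x + y ≡ t + t → y < t → t < x
exceeds x+y≡t+t y<t = ≰⇒> λ x≤t → <-irrefl x+y≡t+t (+-mono-≤-< x≤t y<t)

-- Either all members of R have the same trace
-- D ∩ A on A — then their petals D ─ A are pairwise disjoint (k ∸ t)-sets, so at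
-- most n/(k ∸ t) of them fit — or two members B, C of R have different traces —
-- then every member of R meets U = (A ∪ B) ∪ (A ∪ C) in more than t points, so
-- D ↦ D ∩ U is injective on R and R has at most 2^∣U∣ ≤ 2^(4k) members.
module IntersectingFamily {n k t : ℕ} (A : Subset n) (R : List (Subset n)) (uniq : Unique R)
  (size-A : ∣ A ∣ ≡ k) (size : ∀ {D} → D ∈ R → ∣ D ∣ ≡ k)
  (trace-size : ∀ {D} → D ∈ R → ∣ D ∩ A ∣ ≡ t)
  (meet : Pairwise (λ D E → ∣ D ∩ E ∣ ≡ t) R) where

  common-trace-bound : (∀ {D E} → D ∈ R → E ∈ R → D ∩ A ≡ E ∩ A) → (k ∸ t) * length R ≤ n
  common-trace-bound same-trace =
    ≤-trans (disjoint-family-bound (_─ A) R uniq petal-size petals-disjoint) (∣p∣≤n (⋃ (map (_─ A) R)))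
    where
      petal-size : ∀ {D} → D ∈ R → k ∸ t ≤ ∣ D ─ A ∣
      petal-size {D} D∈ = ≤-reflexive (begin
        k ∸ t                      ≡⟨ cong (_∸ t) (trans (sym (size D∈)) (∣p∣≡∣p∩q∣+∣p─q∣ D A)) ⟩
        ∣ D ∩ A ∣ + ∣ D ─ A ∣ ∸ t  ≡⟨ cong (λ s → s + ∣ D ─ A ∣ ∸ t) (trace-size D∈) ⟩
        t + ∣ D ─ A ∣ ∸ t          ≡⟨ m+n∸m≡n t _ ⟩
        ∣ D ─ A ∣                  ∎)
        where open ≡-Reasoning
      petals-disjoint : Pairwise (λ D E → ∣ (D ─ A) ∩ (E ─ A) ∣ ≡ 0) R
      petals-disjoint {D} {E} D∈ E∈ D≢E = +-cancelˡ-≡ t _ _ (begin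
        t + ∣ (D ─ A) ∩ (E ─ A) ∣          ≡⟨ cong₂ _+_ (sym kernel) (cong ∣_∣ (─-∩-distrib D E A)) ⟩
        ∣ (D ∩ E) ∩ A ∣ + ∣ (D ∩ E) ─ A ∣  ≡⟨ sym (∣p∣≡∣p∩q∣+∣p─q∣ (D ∩ E) A) ⟩
        ∣ D ∩ E ∣                          ≡⟨ meet D∈ E∈ D≢E ⟩
        t                                  ≡⟨ sym (+-identityʳ t) ⟩
        t + 0                              ∎)
        where
          open ≡-Reasoning
          -- D ∩ E contains the common trace, which already has t points
          kernel : ∣ (D ∩ E) ∩ A ∣ ≡ t
          kernel = begin
            ∣ (D ∩ E) ∩ A ∣            ≡⟨ cong ∣_∣ (∩-trace D E A) ⟩
            ∣ (D ∩ A) ∩ (E ∩ A) ∣      ≡⟨ cong (λ S → ∣ (D ∩ A) ∩ S ∣) (same-trace E∈ D∈) ⟩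
            ∣ (D ∩ A) ∩ (D ∩ A) ∣      ≡⟨ cong ∣_∣ (∩-idem (D ∩ A)) ⟩
            ∣ D ∩ A ∣                  ≡⟨ trace-size D∈ ⟩
            t                          ∎

  beyond-trace : ∀ {D Y V} → D ∈ R → Y ∈ R → D ∩ A ≢ Y ∩ A → A ∪ Y ⊆ V → t < ∣ D ∩ V ∣
  beyond-trace {D} {Y} D∈ Y∈ traces-differ A∪Y⊆V =
    <-≤-trans (exceeds split shared) (∣p∩q∣≤∣p∩r∣ D A∪Y⊆V)
    where
      D≢Y : D ≢ Y
      D≢Y refl = traces-differ refl
      shared : ∣ (D ∩ A) ∩ (D ∩ Y) ∣ < t
      shared = subst (_< t) (cong ∣_∣ (sym (∩-trace-pair D Y A)))
        (∣p∩q∣<m (D ∩ A) (Y ∩ A) (trace-size D∈) (trace-size Y∈) traces-differ)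
      split : ∣ D ∩ (A ∪ Y) ∣ + ∣ (D ∩ A) ∩ (D ∩ Y) ∣ ≡ t + t
      split = begin
        ∣ D ∩ (A ∪ Y) ∣ + ∣ (D ∩ A) ∩ (D ∩ Y) ∣          ≡⟨ cong (λ S → ∣ S ∣ + ∣ (D ∩ A) ∩ (D ∩ Y) ∣) (∩-distribˡ-∪ D A Y) ⟩
        ∣ (D ∩ A) ∪ (D ∩ Y) ∣ + ∣ (D ∩ A) ∩ (D ∩ Y) ∣    ≡⟨ ∣∪∣+∣∩∣ (D ∩ A) (D ∩ Y) ⟩
        ∣ D ∩ A ∣ + ∣ D ∩ Y ∣                            ≡⟨ cong₂ _+_ (trace-size D∈) (meet D∈ Y∈ D≢Y) ⟩
        t + t                                            ∎
        where open ≡-Reasoning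

  two-traces-bound : ∀ {B C} → B ∈ R → C ∈ R → B ∩ A ≢ C ∩ A → length R ≤ 2 ^ (4 * k)
  two-traces-bound {B} {C} B∈ C∈ B≢C = begin
    length R                  ≡⟨ sym (length-map (_∩ U) R) ⟩
    length (map (_∩ U) R)     ≤⟨ subsets-bound U (map (_∩ U) R) (map-unique (_∩ U) uniq separated) inside-U ⟩
    2 ^ ∣ U ∣                 ≤⟨ ^-monoʳ-≤ 2 size-U ⟩
    2 ^ (4 * k)               ∎
    where
      open ≤-Reasoning
      U : Subset n
      U = (A ∪ B) ∪ (A ∪ C)
      heavy : ∀ {D} → D ∈ R → t < ∣ D ∩ U ∣
      heavy {D} D∈ with ≡-dec Bool._≟_ (D ∩ A) (B ∩ A)
      ... | no D≢B = beyond-trace D∈ B∈ D≢B (p⊆p∪q (A ∪ C))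
      ... | yes D≡B = beyond-trace D∈ C∈ (λ D≡C → B≢C (trans (sym D≡B) D≡C)) (q⊆p∪q (A ∪ B) (A ∪ C))
      separated : Pairwise (λ D E → D ∩ U ≢ E ∩ U) R
      separated {D} {E} D∈ E∈ D≢E same = <⇒≱ (heavy D∈) (begin
        ∣ D ∩ U ∣  ≤⟨ p⊆q⇒∣p∣≤∣q∣ within ⟩
        ∣ D ∩ E ∣  ≡⟨ meet D∈ E∈ D≢E ⟩
        t          ∎)
        where
          within : D ∩ U ⊆ D ∩ E
          within {x} x∈ = x∈p∩q⁺ (p∩q⊆p D U x∈ , p∩q⊆p E U (subst (x ∈ₛ_) same x∈))
      inside-U : ∀ {X} → X ∈ map (_∩ U) R → X ⊆ U
      inside-U X∈ with ∈-map⁻ (_∩ U) X∈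
      ... | D , _ , refl = p∩q⊆q D U
      size-U : ∣ U ∣ ≤ 4 * k
      size-U = begin
        ∣ U ∣                                 ≤⟨ ∣p∪q∣≤∣p∣+∣q∣ (A ∪ B) (A ∪ C) ⟩
        ∣ A ∪ B ∣ + ∣ A ∪ C ∣                 ≤⟨ +-mono-≤ (∣p∪q∣≤∣p∣+∣q∣ A B) (∣p∪q∣≤∣p∣+∣q∣ A C) ⟩
        (∣ A ∣ + ∣ B ∣) + (∣ A ∣ + ∣ C ∣)     ≡⟨ cong₂ _+_ (cong₂ _+_ size-A (size B∈)) (cong₂ _+_ size-A (size C∈)) ⟩
        (k + k) + (k + k)                     ≡⟨ four k ⟩
        4 * k                                 ∎
        where
          four : ∀ k → (k + k) + (k + k) ≡ 4 * k
          four = solve-∀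

  bound : (k ∸ t) * length R ≤ n + (k ∸ t) * 2 ^ (4 * k)
  bound with constant-or-separates (≡-dec Bool._≟_) (_∩ A) R
  ... | inj₁ same-trace = ≤-trans (common-trace-bound same-trace) (m≤m+n n _)
  ... | inj₂ (B , C , B∈ , C∈ , B≢C) = ≤-trans (*-monoʳ-≤ (k ∸ t) (two-traces-bound B∈ C∈ B≢C)) (m≤n+m _ n)

intersecting-family-bound : ∀ {n k t} (F : List (Subset n)) → Unique F → (∀ {D} → D ∈ F → ∣ D ∣ ≡ k)
  → Pairwise (λ D E → ∣ D ∩ E ∣ ≡ t) F → (k ∸ t) * length F ≤ n + (k ∸ t) * suc (2 ^ (4 * k))
intersecting-family-bound {k = k} {t} [] _ _ _ = ≤-trans (≤-reflexive (*-zeroʳ (k ∸ t))) z≤n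
intersecting-family-bound {n} {k} {t} (A ∷ R) (A∉ ∷ uniq) size meet = begin
  (k ∸ t) * suc (length R)                    ≡⟨ *-suc (k ∸ t) (length R) ⟩
  (k ∸ t) + (k ∸ t) * length R                ≤⟨ +-monoʳ-≤ (k ∸ t) (IntersectingFamily.bound A R uniq
                                                   (size (here refl)) (λ D∈ → size (there D∈))
                                                   (λ D∈ → meet (there D∈) (here refl) (≢-sym (All.lookup A∉ D∈)))
                                                   (λ D∈ E∈ → meet (there D∈) (there E∈))) ⟩
  (k ∸ t) + (n + (k ∸ t) * 2 ^ (4 * k))       ≡⟨ regroup (k ∸ t) n (2 ^ (4 * k)) ⟩
  n + (k ∸ t) * suc (2 ^ (4 * k))             ∎
  where
    open ≤-Reasoning
    regroup : ∀ m n p → m + (n + m * p) ≡ n + m * suc p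
    regroup = solve-∀

-- For d = 2j, translating a d-equilateral set z ∷ S by z gives the family of
-- 2j-sets z ⊕ x (x ∈ S) with pairwise intersections of size j; hence
-- e_{2j}(n) ≤ n/j + O_j(1).
even-equilateral-bound : ∀ {n} j (S : List (Vertex n)) → Equilateral (2 * j) S
  → j * length S ≤ n + j * (2 + 2 ^ (4 * (2 * j)))
even-equilateral-bound j [] _ = ≤-trans (≤-reflexive (*-zeroʳ j)) z≤n
even-equilateral-bound {n} j (z ∷ S) (_ , z∉ ∷ uniq , dist) = begin
  j * suc (length S)                        ≡⟨ *-suc j (length S) ⟩
  j + j * length S                          ≡⟨ cong (λ m → j + j * m) (sym (length-map (z ⊕_) S)) ⟩
  j + j * length F                          ≤⟨ +-monoʳ-≤ j translated-bound ⟩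
  j + (n + j * suc (2 ^ (4 * (2 * j))))     ≡⟨ regroup j n (2 ^ (4 * (2 * j))) ⟩
  n + j * (2 + 2 ^ (4 * (2 * j)))           ∎
  where
    open ≤-Reasoning
    F : List (Subset n)
    F = map (z ⊕_) S
    z∈ : z ∈ z ∷ S
    z∈ = here refl
    F-size : ∀ {X} → X ∈ F → ∣ X ∣ ≡ 2 * j
    F-size X∈ with ∈-map⁻ (z ⊕_) X∈
    ... | x , x∈ , refl = trans (sym (ρ≡∣⊕∣ z x)) (dist z∈ (there x∈) (All.lookup z∉ x∈))
    F-meet : Pairwise (λ X Y → ∣ X ∩ Y ∣ ≡ j) F
    F-meet X∈ Y∈ X≢Y with ∈-map⁻ (z ⊕_) X∈ | ∈-map⁻ (z ⊕_) Y∈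
    ... | x , x∈ , refl | y , y∈ , refl = *-cancelˡ-≡ _ j 2 (equilateral-triangle z x y
      (dist z∈ (there x∈) (All.lookup z∉ x∈)) (dist z∈ (there y∈) (All.lookup z∉ y∈))
      (dist (there x∈) (there y∈) λ x≡y → X≢Y (cong (z ⊕_) x≡y)))
    2j∸j≡j : 2 * j ∸ j ≡ j
    2j∸j≡j = trans (cong (λ m → j + m ∸ j) (+-identityʳ j)) (m+n∸m≡n j j)
    translated-bound : j * length F ≤ n + j * suc (2 ^ (4 * (2 * j)))
    translated-bound = subst (λ μ → μ * length F ≤ n + μ * suc (2 ^ (4 * (2 * j)))) 2j∸j≡j
      (intersecting-family-bound F (Unique.map⁺ (⊕-injective z) uniq) F-size F-meet)
    regroup : ∀ j n p → j + (n + j * suc p) ≡ n + j * (2 + p)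
    regroup = solve-∀

ρ-refl : ∀ {n} (x : Vertex n) → ρ x x ≡ 0
ρ-refl [] = refl
ρ-refl (false ∷ x) = ρ-refl x
ρ-refl (true ∷ x) = ρ-refl x

ρ-sym : ∀ {n} (x y : Vertex n) → ρ x y ≡ ρ y x
ρ-sym [] [] = refl
ρ-sym (a ∷ x) (b ∷ y) = cong₂ _+_ (cong bit (Bool.xor-comm a b)) (ρ-sym x y)

ρ-++ : ∀ {a b} (x u : Vertex a) (y v : Vertex b) → ρ (x ++ y) (u ++ v) ≡ ρ x u + ρ y v
ρ-++ [] [] y v = refl
ρ-++ (p ∷ x) (q ∷ u) y v = trans (cong (bit (p xor q) +_) (ρ-++ x u y v)) (sym (+-assoc (bit (p xor q)) _ _))

ρ-∅ : ∀ {n} (x : Vertex n) → ρ ∅ x ≡ ∣ x ∣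
ρ-∅ [] = refl
ρ-∅ (b ∷ x) = trans (cong (bit b +_) (ρ-∅ x)) (sym (∣∷∣ b x))

ρ-full-∅ : ∀ j → ρ (full {j}) ∅ ≡ j
ρ-full-∅ zero = refl
ρ-full-∅ (suc j) = cong suc (ρ-full-∅ j)

∣∅++x∣ : ∀ j {m} (x : Vertex m) → ∣ ∅ {j} ++ x ∣ ≡ ∣ x ∣
∣∅++x∣ zero x = refl
∣∅++x∣ (suc j) x = ∣∅++x∣ j x

∣full++∅∣ : ∀ j m → ∣ full {j} ++ ∅ {m} ∣ ≡ j
∣full++∅∣ zero m = ∣⊥∣≡0 m
∣full++∅∣ (suc j) m = cong suc (∣full++∅∣ j m)

blocks : ∀ j m → List (Vertex (m * j))
blocks j zero = []
blocks j (suc m) = (full {j} ++ ∅) ∷ map (∅ {j} ++_) (blocks j m)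

length-blocks : ∀ j m → length (blocks j m) ≡ m
length-blocks j zero = refl
length-blocks j (suc m) = cong suc (trans (length-map (∅ {j} ++_) (blocks j m)) (length-blocks j m))

blocks-weight : ∀ j m → All (λ x → ∣ x ∣ ≡ j) (blocks j m)
blocks-weight j zero = []
blocks-weight j (suc m) = ∣full++∅∣ j (m * j) ∷ All.map⁺ (All.map (λ {x} ∣x∣≡j → trans (∣∅++x∣ j x) ∣x∣≡j) (blocks-weight j m))

blocks-distance : ∀ j m → AllPairs (λ x y → ρ x y ≡ 2 * j) (blocks j m)
blocks-distance j zero = []
blocks-distance j (suc m) =
  All.map⁺ (All.map (λ {x} → from-first x) (blocks-weight j m))
  ∷ AllPairs.map⁺ (AllPairs.map (λ {x} {y} → trans (padded x y)) (blocks-distance j m))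
  where
    from-first : ∀ x → ∣ x ∣ ≡ j → ρ (full {j} ++ ∅) (∅ {j} ++ x) ≡ 2 * j
    from-first x ∣x∣≡j = trans (ρ-++ (full {j}) ∅ ∅ x)
      (cong₂ _+_ (ρ-full-∅ j) (trans (ρ-∅ x) (trans ∣x∣≡j (sym (+-identityʳ j)))))
    padded : ∀ (x y : Vertex (m * j)) → ρ (∅ {j} ++ x) (∅ ++ y) ≡ ρ x y
    padded x y = trans (ρ-++ (∅ {j}) ∅ x y) (cong (_+ ρ x y) (ρ-refl (∅ {j})))

blocks-equilateral : ∀ j m → 0 < j → Equilateral (2 * j) (blocks j (suc m))
blocks-equilateral j m 0<j =
  (λ ()) , AllPairs.map distinct (blocks-distance j (suc m)) , allPairs⇒pairwise (λ {x} {y} → trans (ρ-sym y x)) (blocks-distance j (suc m))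
  where
    distinct : ∀ {x y} → ρ x y ≡ 2 * j → x ≢ y
    distinct {x} ρxy≡2j refl = <⇒≢ (≤-trans 0<j (m≤m+n j _)) (trans (sym (ρ-refl x)) ρxy≡2j)

limsup-squeeze : (f : ℕ → ℕ) (p q c : ℕ) → 0 < q
  → (∀ n → 1 ≤ n → q * f n ≤ p * n + c)
  → (∀ N → ∃ λ n → N ≤ n × 1 ≤ n × p * n ≤ q * f n)
  → LimsupRatio f p q
limsup-squeeze f p q c 0<q upper often = eventually-below , often-above
  where
    eventually-below : ∀ k → 1 ≤ k → ∃ λ N → ∀ n → N ≤ n → k * q * f n ≤ k * p * n + q * n
    eventually-below k _ = suc (k * c) , λ n kc<n → begin
      k * q * f n        ≡⟨ *-assoc k q (f n) ⟩
      k * (q * f n)      ≤⟨ *-monoʳ-≤ k (upper n (≤-trans (s≤s z≤n) kc<n)) ⟩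
      k * (p * n + c)    ≡⟨ distribute k p n c ⟩
      k * p * n + k * c  ≤⟨ +-monoʳ-≤ (k * p * n) (≤-trans (<⇒≤ kc<n) (n≤q*n n)) ⟩
      k * p * n + q * n  ∎
      where
        open ≤-Reasoning
        distribute : ∀ k p n c → k * (p * n + c) ≡ k * p * n + k * c
        distribute = solve-∀
        n≤q*n : ∀ n → n ≤ q * n
        n≤q*n n = ≤-trans (≤-reflexive (sym (*-identityˡ n))) (*-monoˡ-≤ n 0<q)
    often-above : ∀ k → 1 ≤ k → ∀ N → ∃ λ n → N ≤ n × 1 ≤ n × k * p * n ≤ k * q * f n + q * n
    often-above k _ N with often N
    ... | n , N≤n , 1≤n , pn≤qfn = n , N≤n , 1≤n , (begin
      k * p * n              ≡⟨ *-assoc k p n ⟩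
      k * (p * n)            ≤⟨ *-monoʳ-≤ k pn≤qfn ⟩
      k * (q * f n)          ≡⟨ sym (*-assoc k q (f n)) ⟩
      k * q * f n            ≤⟨ m≤m+n (k * q * f n) (q * n) ⟩
      k * q * f n + q * n    ∎)
      where open ≤-Reasoning

max-bounded : ∀ {d n m} (P : ℕ → Set) → IsEqMax d n m → (∀ S → Equilateral d S → P (length S)) → P m
max-bounded P ((S , S-equilateral , refl) , _) bound = bound S S-equilateral

blocks-lower-bound : ∀ {e} j m → 0 < j → IsEqMax (2 * j) (suc m * j) e → suc m ≤ e
blocks-lower-bound {e} j m 0<j (_ , maximal) =
  subst (_≤ e) (length-blocks j (suc m)) (maximal (blocks j (suc m)) (blocks-equilateral j m 0<j))

odd-limsup : ∀ i (e : ℕ → ℕ) → (∀ n → 1 ≤ n → IsEqMax (suc (2 * i)) n (e n)) → LimsupRatio e 0 1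
odd-limsup i e isMax = limsup-squeeze e 0 1 2 ≤-refl at-most-two λ N → suc N , n≤1+n N , s≤s z≤n , z≤n
  where
    at-most-two : ∀ n → 1 ≤ n → 1 * e n ≤ 0 * n + 2
    at-most-two n 1≤n = max-bounded (λ m → 1 * m ≤ 2) (isMax n 1≤n)
      λ S S-eq → subst (_≤ 2) (sym (*-identityˡ (length S))) (odd-equilateral-size i S S-eq)

even-limsup : ∀ j → 0 < j → (e : ℕ → ℕ) → (∀ n → 1 ≤ n → IsEqMax (2 * j) n (e n)) → LimsupRatio e 2 (2 * j)
even-limsup j 0<j e isMax = limsup-squeeze e 2 (2 * j) (2 * c) (≤-trans 0<j (m≤m+n j _)) upper often
  where
    c : ℕ
    c = j * (2 + 2 ^ (4 * (2 * j)))
    upper : ∀ n → 1 ≤ n → 2 * j * e n ≤ 2 * n + 2 * c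
    upper n 1≤n = max-bounded (λ m → 2 * j * m ≤ 2 * n + 2 * c) (isMax n 1≤n) λ S S-eq → begin
      2 * j * length S      ≡⟨ *-assoc 2 j (length S) ⟩
      2 * (j * length S)    ≤⟨ *-monoʳ-≤ 2 (even-equilateral-bound j S S-eq) ⟩
      2 * (n + c)           ≡⟨ *-distribˡ-+ 2 n c ⟩
      2 * n + 2 * c         ∎
      where open ≤-Reasoning
    often : ∀ N → ∃ λ n → N ≤ n × 1 ≤ n × 2 * n ≤ 2 * j * e n
    often N = suc N * j , <⇒≤ N<n , ≤-trans (s≤s z≤n) N<n , (begin
      2 * (suc N * j)        ≡⟨ reorder N j ⟩
      2 * j * suc N          ≤⟨ *-monoʳ-≤ (2 * j) (blocks-lower-bound j N 0<j (isMax _ (≤-trans (s≤s z≤n) N<n))) ⟩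
      2 * j * e (suc N * j)  ∎)
      where
        open ≤-Reasoning
        N<n : N < suc N * j
        N<n = ≤-trans (≤-reflexive (sym (*-identityʳ (suc N)))) (*-monoʳ-≤ (suc N) 0<j)
        reorder : ∀ N j → 2 * (suc N * j) ≡ 2 * j * suc N
        reorder = solve-∀

theorem4p1 : (d : ℕ) → 1 ≤ d → (e : ℕ → ℕ)
    → (∀ n → 1 ≤ n → IsEqMax d n (e n))
    → (Odd d → LimsupRatio e 0 1) × (Even d → LimsupRatio e 2 d)
theorem4p1 d 1≤d e isMax = odd-case , even-case
  where
    odd-case : Odd d → LimsupRatio e 0 1
    odd-case (i , refl) = odd-limsup i e isMax
    even-case : Even d → LimsupRatio e 2 d
    even-case (zero , refl) = ⊥-elim (<-irrefl refl 1≤d)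
    even-case (suc j , refl) = even-limsup (suc j) (s≤s z≤n) e isMax
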